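{- Let $S_1,S_2$ be finite sets, $\varphi_1\colon 2^{S_1}\to\mathbb{R}_+$ a coverage function and $\varphi_2\colon 2^{S_2}\to\mathbb{R}$ an increasing submodular function with $\varphi_2(\emptyset)=0$. Then $\varphi_1$ and $\varphi_2$ have a tensor product which is increasing and submodular.
   Context: A coverage function is a function of the form $\varphi(X)=\sum_{t\in N(X)}w_t$ for a bipartite graph $G=(S,T;E)$ and weights $w\in\mathbb{R}_+^T$, where $N(X)$ is the neighbourhood of $X$ in $G$. A tensor product of $\varphi_1,\varphi_2$ is a function $\varphi$ on $2^{S_1\times S_2}$ with $\varphi(X_1\times X_2)=\varphi_1(X_1)\varphi_2(X_2)$ for all $X_1\subseteq S_1$, $X_2\subseteq S_2$. -}

module Defs where

open import Level using (Level; _⊔_) renaming (suc to lsuc)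
open import Data.Bool using (Bool; true; false; _∧_; _∨_; if_then_else_; T)
open import Data.Fin using (Fin; zero; suc)
open import Data.Nat using (ℕ; zero; suc)
open import Data.Product using (_×_; _,_; Σ; ∃)
open import Algebra.Bundles using (CommutativeRing)
open import Relation.Binary.Structures using (IsTotalOrder)
open import Relation.Binary.Core using (Rel)

-- Totally ordered commutative rings (ℝ is an instance).  The paper's
-- functions take values in ℝ; agda-stdlib has no reals, so we work over
-- an arbitrary totally ordered commutative ring.

record OrderedCommutativeRing (c ℓ₁ ℓ₂ : Level) : Set (lsuc (c ⊔ ℓ₁ ⊔ ℓ₂)) where
  field
    commutativeRing : CommutativeRing c ℓ₁
  open CommutativeRing commutativeRing public
  infix 4 _≤_
  field
    _≤_           : Rel Carrier ℓ₂
    isTotalOrder  : IsTotalOrder _≈_ _≤_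
    +-monoˡ-≤     : ∀ {x y} z → x ≤ y → x + z ≤ y + z
    *-nonneg      : ∀ {x y} → 0# ≤ x → 0# ≤ y → 0# ≤ x * y
  open IsTotalOrder isTotalOrder public
    using () renaming (refl to ≤-refl; trans to ≤-trans; antisym to ≤-antisym; total to ≤-total)

Subset : ∀ {a} → Set a → Set a
Subset A = A → Bool

module _ {a} {A : Set a} where
  ∅ : Subset A
  ∅ _ = false

  _∪_ : Subset A → Subset A → Subset A
  (X ∪ Y) x = X x ∨ Y x

  _∩_ : Subset A → Subset A → Subset A
  (X ∩ Y) x = X x ∧ Y x

  _⊆_ : Subset A → Subset A → Set a
  X ⊆ Y = ∀ x → T (X x) → T (Y x)

_⊗_ : ∀ {a b} {A : Set a} {B : Set b} → Subset A → Subset B → Subset (A × B)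
(X₁ ⊗ X₂) (x , y) = X₁ x ∧ X₂ y

anyFin : ∀ n → (Fin n → Bool) → Bool
anyFin zero    f = false
anyFin (suc n) f = f zero ∨ anyFin n (λ i → f (suc i))

module SetFunctions {c ℓ₁ ℓ₂} (R : OrderedCommutativeRing c ℓ₁ ℓ₂) where
  open OrderedCommutativeRing R using (Carrier; _≈_; _≤_; _+_; _*_; 0#)

  SetFun : ∀ {a} → Set a → Set (a ⊔ c)
  SetFun A = Subset A → Carrier

  ∑ : ∀ m → (Fin m → Carrier) → Carrier
  ∑ zero    f = 0#
  ∑ (suc m) f = f zero + ∑ m (λ i → f (suc i))

  -- Neighbourhood N(X) ⊆ T of X ⊆ S in a bipartite graph G = (S, T; E),
  -- S = Fin n, T = Fin m, E given by its adjacency predicate.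
  N : ∀ {n m} → (Fin n → Fin m → Bool) → Subset (Fin n) → Subset (Fin m)
  N {n} E X t = anyFin n (λ s → X s ∧ E s t)

  IsCoverage : ∀ {n} → SetFun (Fin n) → Set (c ⊔ ℓ₁ ⊔ ℓ₂)
  IsCoverage {n} φ =
    Σ ℕ λ m → Σ (Fin n → Fin m → Bool) λ E → Σ (Fin m → Carrier) λ w →
      (∀ t → 0# ≤ w t) ×
      (∀ X → φ X ≈ ∑ m (λ t → if N E X t then w t else 0#))

  Increasing : ∀ {a} {A : Set a} → SetFun A → Set (a ⊔ ℓ₂)
  Increasing φ = ∀ X Y → X ⊆ Y → φ X ≤ φ Y

  Submodular : ∀ {a} {A : Set a} → SetFun A → Set (a ⊔ ℓ₂)
  Submodular φ = ∀ X Y → φ (X ∪ Y) + φ (X ∩ Y) ≤ φ X + φ Y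

  IsTensorProduct : ∀ {a b} {A : Set a} {B : Set b} →
    SetFun (A × B) → SetFun A → SetFun B → Set (a ⊔ b ⊔ ℓ₁)
  IsTensorProduct φ φ₁ φ₂ = ∀ X₁ X₂ → φ (X₁ ⊗ X₂) ≈ φ₁ X₁ * φ₂ X₂

{-# OPTIONS --safe #-}
-- With φ₁(X) = Σ_{t ∈ N(X)} w_t, take φ(X) = Σ_t w_t φ₂(X_t), where the slice X_t consists of
-- the s₂ such that (s₁, s₂) ∈ X for some s₁ adjacent to t. The slice of a rectangle X₁ × X₂ is
-- X₂ when t ∈ N(X₁) and ∅ otherwise, so φ₂(∅) = 0 makes φ a tensor product of φ₁ and φ₂.
-- Slicing preserves inclusions and unions, hence every X ↦ φ₂(X_t) is increasing and
-- submodular, and both properties survive nonnegative linear combinations.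
module Submission where

open import Defs
open import Level using (Level)
open import Data.Nat using (ℕ; zero; suc)
open import Data.Fin using (Fin; zero; suc)
open import Data.Product using (_×_; Σ; ∃; _,_; proj₁; proj₂; map)
open import Data.Sum using (inj₁; inj₂)
import Data.Sum as Sum
open import Data.Bool using (Bool; true; false; _∧_; if_then_else_; T)
open import Data.Bool.Properties using (T-∧; T-∨)
open import Function using (id; _∘_; _⇔_; mk⇔; Equivalence)
open import Relation.Binary.Bundles using (Poset)
open import Relation.Binary.Structures using (IsTotalOrder)
import Algebra.Properties.Group as GroupProperties
import Algebra.Properties.CommutativeSemigroup as CommutativeSemigroupProperties
import Relation.Binary.Reasoning.PartialOrder as PosetReasoning

open Equivalence using (to; from)

anyFin-intro : ∀ n (f : Fin n → Bool) i → T (f i) → T (anyFin n f)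
anyFin-intro (suc n) f zero    p = from (T-∨ {f zero}) (inj₁ p)
anyFin-intro (suc n) f (suc i) p = from (T-∨ {f zero}) (inj₂ (anyFin-intro n (f ∘ suc) i p))

anyFin-elim : ∀ n (f : Fin n → Bool) → T (anyFin n f) → ∃ λ i → T (f i)
anyFin-elim (suc n) f p with to (T-∨ {f zero}) p
... | inj₁ p₀ = zero , p₀
... | inj₂ p₊ = map suc (λ q → q) (anyFin-elim n (f ∘ suc) p₊)

module _ {a} {A : Set a} where

  ∩-⊆ˡ : ∀ {X Y : Subset A} → (X ∩ Y) ⊆ X
  ∩-⊆ˡ {X} x = proj₁ ∘ to (T-∧ {X x})

  ∩-⊆ʳ : ∀ {X Y : Subset A} → (X ∩ Y) ⊆ Y
  ∩-⊆ʳ {X} x = proj₂ ∘ to (T-∧ {X x})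

module _ {c ℓ₁ ℓ₂ : Level} (R : OrderedCommutativeRing c ℓ₁ ℓ₂) where
  open OrderedCommutativeRing R hiding (zero)
  open SetFunctions R
  open GroupProperties +-group using (//-rightDividesˡ)
  open CommutativeSemigroupProperties +-commutativeSemigroup using (interchange)

  poset : Poset c ℓ₁ ℓ₂
  poset = record { isPartialOrder = IsTotalOrder.isPartialOrder isTotalOrder }

  open PosetReasoning poset

  +-mono-≤ : ∀ {a b x y} → a ≤ b → x ≤ y → a + x ≤ b + y
  +-mono-≤ {a} {b} {x} {y} a≤b x≤y = begin
    a + x  ≤⟨ +-monoˡ-≤ x a≤b ⟩
    b + x  ≈⟨ +-comm b x ⟩
    x + b  ≤⟨ +-monoˡ-≤ b x≤y ⟩
    y + b  ≈⟨ +-comm y b ⟩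
    b + y  ∎

  *-monoˡ-≤-nonneg : ∀ {w a b} → 0# ≤ w → a ≤ b → w * a ≤ w * b
  *-monoˡ-≤-nonneg {w} {a} {b} 0≤w a≤b = begin
    w * a                ≈⟨ +-identityˡ (w * a) ⟨
    0# + w * a           ≤⟨ +-monoˡ-≤ (w * a) (*-nonneg 0≤w 0≤b-a) ⟩
    w * (b - a) + w * a  ≈⟨ distribˡ w (b - a) a ⟨
    w * (b - a + a)      ≈⟨ *-congˡ (//-rightDividesˡ a b) ⟩
    w * b                ∎
    where
    0≤b-a : 0# ≤ b - a
    0≤b-a = begin
      0#     ≈⟨ -‿inverseʳ a ⟨
      a - a  ≤⟨ +-monoˡ-≤ (- a) a≤b ⟩
      b - a  ∎

  ∑-mono-≤ : ∀ m {f g : Fin m → Carrier} → (∀ i → f i ≤ g i) → ∑ m f ≤ ∑ m g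
  ∑-mono-≤ zero    f≤g = ≤-refl
  ∑-mono-≤ (suc m) f≤g = +-mono-≤ (f≤g zero) (∑-mono-≤ m (f≤g ∘ suc))

  ∑-cong : ∀ m {f g : Fin m → Carrier} → (∀ i → f i ≈ g i) → ∑ m f ≈ ∑ m g
  ∑-cong zero    f≈g = refl
  ∑-cong (suc m) f≈g = +-cong (f≈g zero) (∑-cong m (f≈g ∘ suc))

  ∑-distrib-+ : ∀ m {f g : Fin m → Carrier} → ∑ m (λ i → f i + g i) ≈ ∑ m f + ∑ m g
  ∑-distrib-+ zero    = sym (+-identityˡ 0#)
  ∑-distrib-+ (suc m) = trans (+-congˡ (∑-distrib-+ m)) (interchange _ _ _ _)

  ∑-distribʳ-* : ∀ m (f : Fin m → Carrier) x → ∑ m (λ i → f i * x) ≈ ∑ m f * x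
  ∑-distribʳ-* zero    f x = sym (zeroˡ x)
  ∑-distribʳ-* (suc m) f x = trans (+-congˡ (∑-distribʳ-* m (f ∘ suc) x)) (sym (distribʳ x _ _))

  module _ {a} {A : Set a} where

    -- Sets are characteristic functions and there is no function extensionality, so
    -- extensionally equal sets have equal values only through monotonicity.
    increasing-cong : {φ : SetFun A} → Increasing φ →
                      ∀ {X Y} → X ⊆ Y → Y ⊆ X → φ X ≈ φ Y
    increasing-cong inc X⊆Y Y⊆X = ≤-antisym (inc _ _ X⊆Y) (inc _ _ Y⊆X)

    increasing-scale : ∀ {w} {φ : SetFun A} → 0# ≤ w → Increasing φ →
                       Increasing (λ X → w * φ X)
    increasing-scale 0≤w inc X Y X⊆Y = *-monoˡ-≤-nonneg 0≤w (inc X Y X⊆Y)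

    submodular-scale : ∀ {w} {φ : SetFun A} → 0# ≤ w → Submodular φ →
                       Submodular (λ X → w * φ X)
    submodular-scale {w} {φ} 0≤w sub X Y = begin
      w * φ (X ∪ Y) + w * φ (X ∩ Y)  ≈⟨ distribˡ w _ _ ⟨
      w * (φ (X ∪ Y) + φ (X ∩ Y))    ≤⟨ *-monoˡ-≤-nonneg 0≤w (sub X Y) ⟩
      w * (φ X + φ Y)                ≈⟨ distribˡ w _ _ ⟩
      w * φ X + w * φ Y              ∎

    increasing-∑ : ∀ m {φ : Fin m → SetFun A} → (∀ t → Increasing (φ t)) →
                   Increasing (λ X → ∑ m (λ t → φ t X))
    increasing-∑ m inc X Y X⊆Y = ∑-mono-≤ m (λ t → inc t X Y X⊆Y)

    submodular-∑ : ∀ m {φ : Fin m → SetFun A} → (∀ t → Submodular (φ t)) →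
                   Submodular (λ X → ∑ m (λ t → φ t X))
    submodular-∑ m {φ} sub X Y = begin
      ∑ m (λ t → φ t (X ∪ Y)) + ∑ m (λ t → φ t (X ∩ Y))  ≈⟨ ∑-distrib-+ m ⟨
      ∑ m (λ t → φ t (X ∪ Y) + φ t (X ∩ Y))              ≤⟨ ∑-mono-≤ m (λ t → sub t X Y) ⟩
      ∑ m (λ t → φ t X + φ t Y)                          ≈⟨ ∑-distrib-+ m ⟩
      ∑ m (λ t → φ t X) + ∑ m (λ t → φ t Y)              ∎

    module _ {b} {B : Set b} {φ : SetFun B} {F : Subset A → Subset B}
             (inc : Increasing φ) (F-mono : ∀ {X Y} → X ⊆ Y → F X ⊆ F Y) where

      increasing-∘ : Increasing (φ ∘ F)
      increasing-∘ X Y X⊆Y = inc _ _ (F-mono X⊆Y)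

      submodular-∘ : Submodular φ → (∀ X Y → F (X ∪ Y) ⊆ (F X ∪ F Y)) →
                     Submodular (φ ∘ F)
      submodular-∘ sub F-∪ X Y = begin
        φ (F (X ∪ Y)) + φ (F (X ∩ Y))      ≤⟨ +-mono-≤ (inc _ _ (F-∪ X Y)) (inc _ _ F-∩) ⟩
        φ (F X ∪ F Y) + φ (F X ∩ F Y)      ≤⟨ sub (F X) (F Y) ⟩
        φ (F X) + φ (F Y)                  ∎
        where
        F-∩ : F (X ∩ Y) ⊆ (F X ∩ F Y)
        F-∩ z p = from T-∧ (F-mono ∩-⊆ˡ z p , F-mono (∩-⊆ʳ {X = X}) z p)

  module _ {n m} (E : Fin n → Fin m → Bool) where

    N-intro : ∀ {X} s {t} → T (X s) → T (E s t) → T (N E X t)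
    N-intro s x e = anyFin-intro n _ s (from T-∧ (x , e))

    N-elim : ∀ {X t} → T (N E X t) → ∃ λ s → T (X s) × T (E s t)
    N-elim {X} p = map id (λ {s} → to (T-∧ {X s})) (anyFin-elim n _ p)

    N-mono : ∀ {X Y} → X ⊆ Y → N E X ⊆ N E Y
    N-mono X⊆Y t p with N-elim p
    ... | s , x , e = N-intro s (X⊆Y s x) e

    N-∪ : ∀ {X Y} → N E (X ∪ Y) ⊆ (N E X ∪ N E Y)
    N-∪ {X} t p with N-elim p
    ... | s , x∨y , e =
      from T-∨ (Sum.map (λ x → N-intro s x e) (λ y → N-intro s y e) (to (T-∨ {X s}) x∨y))

    coverage : (Fin m → Carrier) → SetFun (Fin n)
    coverage w X = ∑ m (λ t → if N E X t then w t else 0#)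

    module _ {b} {B : Set b} where

      slice : Subset (Fin n × B) → Fin m → Subset B
      slice X t y = N E (λ x → X (x , y)) t

      slice-mono : ∀ {X Y} t → X ⊆ Y → slice X t ⊆ slice Y t
      slice-mono t X⊆Y y = N-mono (λ x → X⊆Y (x , y)) t

      slice-∪ : ∀ X Y t → slice (X ∪ Y) t ⊆ (slice X t ∪ slice Y t)
      slice-∪ X Y t y = N-∪ t

      T-slice-⊗ : ∀ X₁ X₂ t y → T (slice (X₁ ⊗ X₂) t y) ⇔ T (N E X₁ t ∧ X₂ y)
      T-slice-⊗ X₁ X₂ t y = mk⇔ slice⇒guard guard⇒slice
        where
        slice⇒guard : T (slice (X₁ ⊗ X₂) t y) → T (N E X₁ t ∧ X₂ y)
        slice⇒guard p with N-elim p
        ... | s , x₁x₂ , e with to (T-∧ {X₁ s}) x₁x₂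
        ... | x₁ , x₂ = from T-∧ (N-intro s x₁ e , x₂)

        guard⇒slice : T (N E X₁ t ∧ X₂ y) → T (slice (X₁ ⊗ X₂) t y)
        guard⇒slice p with to (T-∧ {N E X₁ t}) p
        ... | q , x₂ with N-elim q
        ... | s , x₁ , e = N-intro s (from T-∧ (x₁ , x₂)) e

      coverageTensor : (Fin m → Carrier) → SetFun B → SetFun (Fin n × B)
      coverageTensor w φ X = ∑ m (λ t → w t * φ (slice X t))

      module _ {w : Fin m → Carrier} {φ : SetFun B} (inc : Increasing φ) where

        coverageTensor-increasing : (∀ t → 0# ≤ w t) → Increasing (coverageTensor w φ)
        coverageTensor-increasing w≥0 = increasing-∑ m λ t →
          increasing-scale (w≥0 t) (increasing-∘ inc (slice-mono t))

        coverageTensor-submodular : (∀ t → 0# ≤ w t) → Submodular φ →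
                                    Submodular (coverageTensor w φ)
        coverageTensor-submodular w≥0 sub = submodular-∑ m λ t →
          submodular-scale (w≥0 t) (submodular-∘ inc (slice-mono t) sub (λ X Y → slice-∪ X Y t))

        coverageTensor-isTensorProduct : φ ∅ ≈ 0# → ∀ {φ₁} → (∀ X → φ₁ X ≈ coverage w X) →
                                         IsTensorProduct (coverageTensor w φ) φ₁ φ
        coverageTensor-isTensorProduct φ∅≈0 {φ₁} φ₁≈cov X₁ X₂ = begin-equality
          ∑ m (λ t → w t * φ (slice (X₁ ⊗ X₂) t))          ≈⟨ ∑-cong m (λ t → *-congˡ (slice-⊗≈ t)) ⟩
          ∑ m (λ t → w t * φ (λ y → N E X₁ t ∧ X₂ y))      ≈⟨ ∑-cong m (λ t → guard-* (N E X₁ t) (w t)) ⟩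
          ∑ m (λ t → (if N E X₁ t then w t else 0#) * φ X₂) ≈⟨ ∑-distribʳ-* m _ (φ X₂) ⟩
          coverage w X₁ * φ X₂                              ≈⟨ *-congʳ (φ₁≈cov X₁) ⟨
          φ₁ X₁ * φ X₂                                      ∎
          where
          slice-⊗≈ : ∀ t → φ (slice (X₁ ⊗ X₂) t) ≈ φ (λ y → N E X₁ t ∧ X₂ y)
          slice-⊗≈ t = increasing-cong inc (λ y → to (T-slice-⊗ X₁ X₂ t y))
                                           (λ y → from (T-slice-⊗ X₁ X₂ t y))

          -- λ y → true ∧ X₂ y is X₂ and λ y → false ∧ X₂ y is ∅, both definitionally.
          guard-* : ∀ c v → v * φ (λ y → c ∧ X₂ y) ≈ (if c then v else 0#) * φ X₂
          guard-* true  v = refl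
          guard-* false v = begin-equality
            v * φ ∅   ≈⟨ *-congˡ φ∅≈0 ⟩
            v * 0#    ≈⟨ zeroʳ v ⟩
            0#        ≈⟨ zeroˡ (φ X₂) ⟨
            0# * φ X₂ ∎

corollary3p13 : ∀ {c ℓ₁ ℓ₂ : Level} (R : OrderedCommutativeRing c ℓ₁ ℓ₂) →
    let open OrderedCommutativeRing R
        open SetFunctions R
    in (n₁ n₂ : ℕ) (φ₁ : SetFun (Fin n₁)) (φ₂ : SetFun (Fin n₂)) →
       IsCoverage φ₁ →
       Increasing φ₂ → Submodular φ₂ → φ₂ ∅ ≈ 0# →
       Σ (SetFun (Fin n₁ × Fin n₂)) λ φ →
         IsTensorProduct φ φ₁ φ₂ × Increasing φ × Submodular φ
corollary3p13 R n₁ n₂ φ₁ φ₂ (m , E , w , w≥0 , φ₁≈cov) inc sub φ₂∅≈0 =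
  coverageTensor R E w φ₂ ,
  coverageTensor-isTensorProduct R E inc φ₂∅≈0 φ₁≈cov ,
  coverageTensor-increasing R E inc w≥0 ,
  coverageTensor-submodular R E inc w≥0 sub
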